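{- For all integers $n \ge 1$ and $d \ge 2$, $\mathrm{HG}\left(W_{d^n - d^{n-1} + 1,\, n}\right) = d^n$.
   Context: Hat-guessing game on a finite simple graph $G$ with $q$ colors: each vertex receives (adversarially) a hat color from $\{0,1,\dots,q-1\}$. Before the colors are assigned, the players agree on a deterministic strategy in which each vertex's guess of its own color is a function only of the colors of its neighbors. The players win if for every color assignment at least one vertex guesses its own color correctly. The hat-guessing number $\mathrm{HG}(G)$ is the largest $q$ for which a winning strategy exists. The windmill graph $W_{k,n}$ is the graph on $(k-1)n+1$ vertices obtained by taking $n$ copies of the complete graph $K_k$ and identifying one vertex from each copy into a single common vertex. -}

module Defs where

open import Data.Nat using (ℕ; zero; suc; _∸_; _*_; _<_)
open import Data.Fin using (Fin; zero; suc; remQuot)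
open import Data.Product using (Σ; ∃; _×_; _,_; proj₁; proj₂)
open import Data.Empty using (⊥)
open import Data.Unit using (⊤)
open import Relation.Nullary using (¬_)
open import Relation.Binary.PropositionalEquality using (_≡_)

record Graph : Set₁ where
  field
    V     : ℕ
    Adj   : Fin V → Fin V → Set
    sym   : ∀ {u v} → Adj u v → Adj v u
    irref : ∀ {v} → ¬ Adj v v

open Graph public

-- Windmill graph W_{k,n}: vertex 0 is the common (centre) vertex; vertex
-- suc i, for i : Fin (n * (k ∸ 1)), is the (remainder)-th non-centre vertex
-- of the (quotient)-th copy of K_k, where remQuot (k ∸ 1) i = (copy , index).
windmillAdj : (k n : ℕ) → Fin (suc (n * (k ∸ 1))) → Fin (suc (n * (k ∸ 1))) → Set
windmillAdj k n zero    zero    = ⊥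
windmillAdj k n zero    (suc j) = ⊤
windmillAdj k n (suc i) zero    = ⊤
windmillAdj k n (suc i) (suc j) =
  (proj₁ (remQuot {n} (k ∸ 1) i) ≡ proj₁ (remQuot {n} (k ∸ 1) j))
  × ¬ (i ≡ j)

windmillSym : ∀ k n {u v} → windmillAdj k n u v → windmillAdj k n v u
windmillSym k n {zero}  {suc j} p = p
windmillSym k n {suc i} {zero}  p = p
windmillSym k n {suc i} {suc j} (e , ne) =
  Relation.Binary.PropositionalEquality.sym e
  , λ q → ne (Relation.Binary.PropositionalEquality.sym q)

windmillIrref : ∀ k n {v} → ¬ windmillAdj k n v v
windmillIrref k n {zero}  ()
windmillIrref k n {suc i} (_ , ne) = ne Relation.Binary.PropositionalEquality.refl

Windmill : (k n : ℕ) → Graph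
Windmill k n = record
  { V = suc (n * (k ∸ 1))
  ; Adj = windmillAdj k n
  ; sym = windmillSym k n
  ; irref = windmillIrref k n
  }

-- A deterministic strategy with q colours: each vertex v guesses a colour
-- from the whole colouring, subject to depending only on neighbours' colours.
Strategy : Graph → ℕ → Set
Strategy G q = Fin (V G) → (Fin (V G) → Fin q) → Fin q

NeighbourLocal : (G : Graph) (q : ℕ) → Strategy G q → Set
NeighbourLocal G q s =
  ∀ v (c c' : Fin (V G) → Fin q) →
    (∀ u → Adj G v u → c u ≡ c' u) → s v c ≡ s v c'

Wins : (G : Graph) (q : ℕ) → Strategy G q → Set
Wins G q s = ∀ (c : Fin (V G) → Fin q) → ∃ λ v → s v c ≡ c v

HasWinningStrategy : Graph → ℕ → Set
HasWinningStrategy G q = Σ (Strategy G q) λ s → NeighbourLocal G q s × Wins G q s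

IsHatGuessingNumber : Graph → ℕ → Set
IsHatGuessingNumber G h =
  HasWinningStrategy G h × (∀ q → h < q → ¬ HasWinningStrategy G q)

module Submission where

-- Colours are the words of n base-d digits, and a blade has M = d^n − d^(n−1) vertices: as many as
-- there are colours whose p-th digit differs from a given one. The centre guesses the colour whose p-th digit is the p-th digit of the sum
-- (mod q) of blade p, for each p. The vertices of blade p are indexed by the colours y whose p-th digit
-- differs from the centre's colour; the one indexed by y bets that its blade sums to y, which
-- determines its own colour from the others in its blade. If the centre is wrong, the sum of some
-- blade p has a p-th digit different from the centre's, so one vertex of blade p bet on it correctly. A player of a clique who ignores its own colour is right on a 1/q fraction of
-- the colourings, so a whole blade is wrong on at least a (1 − M/q) fraction of them. Given the
-- centre's colour the blades are independent, and the centre is right on a 1/q fraction of all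
-- colourings; so some colouring defeats everyone once q (1 − M/q)^n > 1, which follows from
-- q ≤ d (q − M) and d^n < q.

open import Defs hiding (sym)
open import Data.Nat
  using (ℕ; zero; suc; _+_; _*_; _∸_; _^_; _≤_; _<_; z≤n; s≤s; NonZero; >-nonZero; >-nonZero⁻¹)
open import Data.Nat.Properties hiding (_≟_)
open import Data.Nat.DivMod using (_%_; _mod_; m%n<n; %-distribˡ-+; m%n%n≡m%n; [m+n]%n≡m%n; m<n⇒m%n≡m)
open import Algebra.Properties.CommutativeSemigroup +-commutativeSemigroup
  using () renaming (interchange to +-interchange)
open import Data.Fin
  using (Fin; zero; suc; toℕ; combine; remQuot; cast; fromℕ<; punchIn; punchOut; finToFun; funToFin; _≟_)
open import Data.Fin.Properties
  using (toℕ-fromℕ<; toℕ-injective; toℕ<n; remQuot-combine; combine-remQuot; combine-injectiveʳ;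
         cast-involutive; punchIn-punchOut; finToFun-funToFin; funToFin-finToFin; all?; ¬∀⟶∃¬)
open import Data.Vec.Functional using (Vector; _∷_; insertAt; removeAt)
open import Data.Vec.Functional.Properties using (insertAt-removeAt)
open import Data.Product using (∃; ∃₂; _×_; _,_; proj₁; proj₂; uncurry)
open import Data.Sum using (_⊎_; inj₁; inj₂)
open import Data.Empty using (⊥-elim)
open import Data.Unit using (tt)
open import Function using (_∘_)
open import Relation.Nullary using (¬_; yes; no)
open import Relation.Binary.PropositionalEquality

record Summation (A : Set) : Set where
  field
    ∑      : (A → ℕ) → ℕ
    card   : ℕ
    ∑-mono : ∀ {f g : A → ℕ} → (∀ a → f a ≤ g a) → ∑ f ≤ ∑ g
    ∑-+    : ∀ (f g : A → ℕ) → ∑ (λ a → f a + g a) ≡ ∑ f + ∑ g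
    ∑-*    : ∀ k (f : A → ℕ) → ∑ (λ a → k * f a) ≡ k * ∑ f
    ∑-1    : ∑ (λ _ → 1) ≡ card
    ∑-pos  : ∀ (f : A → ℕ) → 0 < ∑ f → ∃ λ a → 0 < f a

  ∑-cong : ∀ {f g : A → ℕ} → (∀ a → f a ≡ g a) → ∑ f ≡ ∑ g
  ∑-cong f≡g = ≤-antisym (∑-mono (≤-reflexive ∘ f≡g)) (∑-mono (≤-reflexive ∘ sym ∘ f≡g))

  ∑-*ʳ : ∀ k (f : A → ℕ) → ∑ (λ a → f a * k) ≡ ∑ f * k
  ∑-*ʳ k f = trans (∑-cong (λ a → *-comm (f a) k)) (trans (∑-* k f) (*-comm k (∑ f)))

  ∑-const : ∀ k → ∑ (λ _ → k) ≡ k * card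
  ∑-const k = trans (∑-cong (λ _ → sym (*-identityʳ k))) (trans (∑-* k (λ _ → 1)) (cong (k *_) ∑-1))

open Summation public

∑Fin : ∀ q → (Fin q → ℕ) → ℕ
∑Fin zero    f = 0
∑Fin (suc q) f = f zero + ∑Fin q (f ∘ suc)

finSummation : ∀ q → Summation (Fin q)
finSummation q = record
  { ∑ = ∑Fin q ; card = q ; ∑-mono = mono q ; ∑-+ = plus q ; ∑-* = scale q
  ; ∑-1 = one q ; ∑-pos = pos q }
  where
  mono : ∀ q {f g : Fin q → ℕ} → (∀ a → f a ≤ g a) → ∑Fin q f ≤ ∑Fin q g
  mono zero    f≤g = z≤n
  mono (suc q) f≤g = +-mono-≤ (f≤g zero) (mono q (f≤g ∘ suc))

  plus : ∀ q (f g : Fin q → ℕ) → ∑Fin q (λ a → f a + g a) ≡ ∑Fin q f + ∑Fin q g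
  plus zero    f g = refl
  plus (suc q) f g = trans (cong (f zero + g zero +_) (plus q (f ∘ suc) (g ∘ suc)))
    (+-interchange (f zero) (g zero) (∑Fin q (f ∘ suc)) (∑Fin q (g ∘ suc)))

  scale : ∀ q k (f : Fin q → ℕ) → ∑Fin q (λ a → k * f a) ≡ k * ∑Fin q f
  scale zero    k f = sym (*-zeroʳ k)
  scale (suc q) k f = trans (cong (k * f zero +_) (scale q k (f ∘ suc)))
    (sym (*-distribˡ-+ k (f zero) (∑Fin q (f ∘ suc))))

  one : ∀ q → ∑Fin q (λ _ → 1) ≡ q
  one zero    = refl
  one (suc q) = cong suc (one q)

  pos : ∀ q (f : Fin q → ℕ) → 0 < ∑Fin q f → ∃ λ a → 0 < f a
  pos (suc q) f ∑>0 with f zero in f₀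
  ... | suc _ = zero , subst (0 <_) (sym f₀) (s≤s z≤n)
  ... | zero  = let a , fa>0 = pos q (f ∘ suc) ∑>0 in suc a , fa>0

∑-swap : ∀ {A : Set} (S : Summation A) m (F : Fin m → A → ℕ) →
  ∑Fin m (λ r → ∑ S (F r)) ≡ ∑ S (λ a → ∑Fin m (λ r → F r a))
∑-swap S zero    F = sym (∑-const S 0)
∑-swap S (suc m) F = trans (cong (∑ S (F zero) +_) (∑-swap S m (F ∘ suc)))
  (sym (∑-+ S (F zero) (λ a → ∑Fin m (λ r → F (suc r) a))))

∏ : ∀ n → (Fin n → ℕ) → ℕ
∏ zero    f = 1
∏ (suc n) f = f zero * ∏ n (f ∘ suc)

module _ {A : Set} (S : Summation A) where

  ∑⃗ : ∀ n → (Vector A n → ℕ) → ℕ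
  ∑⃗ zero    f = f (λ ())
  ∑⃗ (suc n) f = ∑ S (λ a → ∑⃗ n (f ∘ (a ∷_)))

  vectorSummation : ∀ n → Summation (Vector A n)
  vectorSummation n = record
    { ∑ = ∑⃗ n ; card = card S ^ n ; ∑-mono = mono n ; ∑-+ = plus n ; ∑-* = scale n
    ; ∑-1 = one n ; ∑-pos = pos n }
    where
    mono : ∀ n {f g : Vector A n → ℕ} → (∀ a → f a ≤ g a) → ∑⃗ n f ≤ ∑⃗ n g
    mono zero    f≤g = f≤g _
    mono (suc n) f≤g = ∑-mono S (λ a → mono n (f≤g ∘ (a ∷_)))

    plus : ∀ n (f g : Vector A n → ℕ) → ∑⃗ n (λ as → f as + g as) ≡ ∑⃗ n f + ∑⃗ n g
    plus zero    f g = refl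
    plus (suc n) f g = trans (∑-cong S (λ a → plus n (f ∘ (a ∷_)) (g ∘ (a ∷_))))
      (∑-+ S (λ a → ∑⃗ n (f ∘ (a ∷_))) (λ a → ∑⃗ n (g ∘ (a ∷_))))

    scale : ∀ n k (f : Vector A n → ℕ) → ∑⃗ n (λ as → k * f as) ≡ k * ∑⃗ n f
    scale zero    k f = refl
    scale (suc n) k f = trans (∑-cong S (λ a → scale n k (f ∘ (a ∷_))))
      (∑-* S k (λ a → ∑⃗ n (f ∘ (a ∷_))))

    one : ∀ n → ∑⃗ n (λ _ → 1) ≡ card S ^ n
    one zero    = refl
    one (suc n) = trans (∑-cong S (λ _ → one n))
      (trans (∑-const S (card S ^ n)) (*-comm (card S ^ n) (card S)))

    pos : ∀ n (f : Vector A n → ℕ) → 0 < ∑⃗ n f → ∃ λ as → 0 < f as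
    pos zero    f ∑>0 = (λ ()) , ∑>0
    pos (suc n) f ∑>0 with ∑-pos S _ ∑>0
    ... | a , ∑a>0 with pos n (f ∘ (a ∷_)) ∑a>0
    ...   | as , fas>0 = (a ∷ as) , fas>0

  ∑⃗-∏ : ∀ n (f : Fin n → A → ℕ) →
    ∑⃗ n (λ as → ∏ n (λ i → f i (as i))) ≡ ∏ n (λ i → ∑ S (f i))
  ∑⃗-∏ zero    f = refl
  ∑⃗-∏ (suc n) f = begin
      ∑ S (λ a → ∑⃗ n (λ as → f zero a * ∏ n (λ i → f (suc i) (as i))))
    ≡⟨ ∑-cong S (λ a → ∑-* (vectorSummation n) (f zero a) _) ⟩
      ∑ S (λ a → f zero a * ∑⃗ n (λ as → ∏ n (λ i → f (suc i) (as i))))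
    ≡⟨ ∑-cong S (λ a → cong (f zero a *_) (∑⃗-∏ n (f ∘ suc))) ⟩
      ∑ S (λ a → f zero a * ∏ n (λ i → ∑ S (f (suc i))))
    ≡⟨ ∑-*ʳ S _ (f zero) ⟩
      ∑ S (f zero) * ∏ n (λ i → ∑ S (f (suc i)))
    ∎
    where open ≡-Reasoning

m*n>0⇒m>0 : ∀ m {n} → 0 < m * n → 0 < m
m*n>0⇒m>0 m m*n>0 = >-nonZero⁻¹ m {{m*n≢0⇒m≢0 m {{>-nonZero m*n>0}}}}

m*n>0⇒n>0 : ∀ m {n} → 0 < m * n → 0 < n
m*n>0⇒n>0 m {n} m*n>0 = >-nonZero⁻¹ n {{m*n≢0⇒n≢0 m {{>-nonZero m*n>0}}}}

∏≤1 : ∀ n {f : Fin n → ℕ} → (∀ i → f i ≤ 1) → ∏ n f ≤ 1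
∏≤1 zero    f≤1 = ≤-refl
∏≤1 (suc n) f≤1 = *-mono-≤ (f≤1 zero) (∏≤1 n (f≤1 ∘ suc))

∏>0⇒>0 : ∀ n {f : Fin n → ℕ} → 0 < ∏ n f → ∀ i → 0 < f i
∏>0⇒>0 (suc n) {f} ∏>0 zero    = m*n>0⇒m>0 (f zero) ∏>0
∏>0⇒>0 (suc n) {f} ∏>0 (suc i) = ∏>0⇒>0 n (m*n>0⇒n>0 (f zero) ∏>0) i

∏-const : ∀ n k → ∏ n (λ _ → k) ≡ k ^ n
∏-const zero    k = refl
∏-const (suc n) k = cong (k *_) (∏-const n k)

∏-mono : ∀ n {f g : Fin n → ℕ} → (∀ i → f i ≤ g i) → ∏ n f ≤ ∏ n g
∏-mono zero    f≤g = ≤-refl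
∏-mono (suc n) f≤g = *-mono-≤ (f≤g zero) (∏-mono n (f≤g ∘ suc))

∏-* : ∀ n (f g : Fin n → ℕ) → ∏ n (λ i → f i * g i) ≡ ∏ n f * ∏ n g
∏-* zero    f g = refl
∏-* (suc n) f g = trans (cong (f zero * g zero *_) (∏-* n (f ∘ suc) (g ∘ suc)))
  ([m*n]*[o*p]≡[m*o]*[n*p] (f zero) (g zero) (∏ n (f ∘ suc)) (∏ n (g ∘ suc)))

^-distribʳ-* : ∀ m n k → (m * n) ^ k ≡ m ^ k * n ^ k
^-distribʳ-* m n k = begin
  (m * n) ^ k                            ≡⟨ ∏-const k (m * n) ⟨
  ∏ k (λ _ → m * n)                      ≡⟨ ∏-* k (λ _ → m) (λ _ → n) ⟩
  ∏ k (λ _ → m) * ∏ k (λ _ → n)          ≡⟨ cong₂ _*_ (∏-const k m) (∏-const k n) ⟩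
  m ^ k * n ^ k                          ∎
  where open ≡-Reasoning

^≤^*∏ : ∀ n {a q} {f : Fin n → ℕ} → (∀ i → a ≤ q * f i) → a ^ n ≤ q ^ n * ∏ n f
^≤^*∏ n {a} {q} {f} a≤qf = begin
  a ^ n                          ≡⟨ ∏-const n a ⟨
  ∏ n (λ _ → a)                  ≤⟨ ∏-mono n a≤qf ⟩
  ∏ n (λ i → q * f i)            ≡⟨ ∏-* n (λ _ → q) f ⟩
  ∏ n (λ _ → q) * ∏ n f          ≡⟨ cong (_* ∏ n f) (∏-const n q) ⟩
  q ^ n * ∏ n f                  ∎
  where open ≤-Reasoning

hit : ∀ {q} → Fin q → Fin q → ℕ
hit zero    zero    = 1
hit zero    (suc _) = 0
hit (suc _) zero    = 0
hit (suc x) (suc y) = hit x y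

miss : ∀ {q} → Fin q → Fin q → ℕ
miss x y = 1 ∸ hit x y

hit≤1 : ∀ {q} (x y : Fin q) → hit x y ≤ 1
hit≤1 zero    zero    = s≤s z≤n
hit≤1 zero    (suc _) = z≤n
hit≤1 (suc _) zero    = z≤n
hit≤1 (suc x) (suc y) = hit≤1 x y

hit-refl : ∀ {q} (x : Fin q) → hit x x ≡ 1
hit-refl zero    = refl
hit-refl (suc x) = hit-refl x

miss-refl : ∀ {q} (x : Fin q) → miss x x ≡ 0
miss-refl x = cong (1 ∸_) (hit-refl x)

miss≤1 : ∀ {q} (x y : Fin q) → miss x y ≤ 1
miss≤1 x y = m∸n≤m 1 (hit x y)

miss+hit≡1 : ∀ {q} (x y : Fin q) → miss x y + hit x y ≡ 1
miss+hit≡1 x y = m∸n+n≡m (hit≤1 x y)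

miss>0⇒≢ : ∀ {q} (x y : Fin q) → 0 < miss x y → x ≢ y
miss>0⇒≢ x .x miss>0 refl = <-irrefl (sym (miss-refl x)) miss>0

∑-sift : ∀ {q} (x : Fin q) (f : Fin q → ℕ) → ∑Fin q (λ y → hit x y * f y) ≡ f x
∑-sift {suc q} zero    f =
  trans (cong₂ _+_ (*-identityˡ (f zero)) (∑-const (finSummation q) 0)) (+-identityʳ (f zero))
∑-sift {suc q} (suc x) f = ∑-sift x (f ∘ suc)

∑-hit : ∀ {q} (x : Fin q) → ∑Fin q (hit x) ≡ 1
∑-hit x = trans (∑-cong (finSummation _) (λ y → sym (*-identityʳ (hit x y)))) (∑-sift x (λ _ → 1))

∑-split-at : ∀ {m} (r : Fin m) (f : Fin m → ℕ) →
  ∑Fin m f ≡ f r + ∑Fin m (λ r' → miss r r' * f r')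
∑-split-at {m} r f = begin
    ∑Fin m f
  ≡⟨ ∑-cong Fm (λ r' → trans (sym (*-identityˡ (f r'))) (cong (_* f r') (sym (miss+hit≡1 r r')))) ⟩
    ∑Fin m (λ r' → (miss r r' + hit r r') * f r')
  ≡⟨ ∑-cong Fm (λ r' → trans (*-distribʳ-+ (f r') (miss r r') (hit r r'))
                              (+-comm (miss r r' * f r') _)) ⟩
    ∑Fin m (λ r' → hit r r' * f r' + miss r r' * f r')
  ≡⟨ ∑-+ Fm (λ r' → hit r r' * f r') (λ r' → miss r r' * f r') ⟩
    ∑Fin m (λ r' → hit r r' * f r') + ∑Fin m (λ r' → miss r r' * f r')
  ≡⟨ cong (_+ ∑Fin m (λ r' → miss r r' * f r')) (∑-sift r f) ⟩
    f r + ∑Fin m (λ r' → miss r r' * f r')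
  ∎
  where
  open ≡-Reasoning
  Fm : Summation (Fin m)
  Fm = finSummation m

1≤[1∸h]*m+[h+n] : ∀ {h m n} → h ≤ 1 → 1 ≤ m + n → 1 ≤ (1 ∸ h) * m + (h + n)
1≤[1∸h]*m+[h+n] {zero}  {m} {n} _ 1≤m+n = subst (λ k → 1 ≤ k + n) (sym (*-identityˡ m)) 1≤m+n
1≤[1∸h]*m+[h+n] {suc zero}      _ _     = s≤s z≤n
1≤[1∸h]*m+[h+n] {suc (suc _)} (s≤s ()) _

L≤[1∸h]*L+h : ∀ {h L} → h ≤ 1 → L ≤ 1 → L ≤ (1 ∸ h) * L + h
L≤[1∸h]*L+h {zero}  {L} _ _   = ≤-reflexive (sym (trans (+-identityʳ (1 * L)) (*-identityˡ L)))
L≤[1∸h]*L+h {suc zero}  _ L≤1 = L≤1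
L≤[1∸h]*L+h {suc (suc _)} (s≤s ()) _

colourings : ∀ q m → Summation (Vector (Fin q) m)
colourings q = vectorSummation (finSummation q)

AgreeOff : ∀ {A : Set} {m} → Fin m → Vector A m → Vector A m → Set
AgreeOff r β β' = ∀ r' → r' ≢ r → β r' ≡ β' r'

IgnoresOwn : ∀ {q m} → Fin m → (Vector (Fin q) m → Fin q) → Set
IgnoresOwn r g = ∀ β β' → AgreeOff r β β' → g β ≡ g β'

agreeOff-head : ∀ {A : Set} {m} (a a' : A) (β : Vector A m) → AgreeOff zero (a ∷ β) (a' ∷ β)
agreeOff-head a a' β zero    0≢0 = ⊥-elim (0≢0 refl)
agreeOff-head a a' β (suc r) _   = refl

agreeOff-tail : ∀ {A : Set} {m} (a : A) {r : Fin m} {β β'} →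
  AgreeOff r β β' → AgreeOff (suc r) (a ∷ β) (a ∷ β')
agreeOff-tail a agree zero     _  = refl
agreeOff-tail a agree (suc r') ne = agree r' (ne ∘ cong suc)

-- Stated multiplied by q, which avoids writing q ^ (m ∸ 1).
∑-hit-ignoring : ∀ q {m} (r : Fin m) (g : Vector (Fin q) m → Fin q) → IgnoresOwn r g →
  q * ∑ (colourings q m) (λ β → hit (g β) (β r)) ≡ q ^ m
∑-hit-ignoring zero    {suc m} r       g ignores = refl
∑-hit-ignoring (suc q) {suc m} zero    g ignores = cong (suc q *_) (begin
    ∑Fin (suc q) (λ c → ∑ Cm (λ ρ → hit (g (c ∷ ρ)) c))
  ≡⟨ ∑-swap Cm (suc q) (λ c ρ → hit (g (c ∷ ρ)) c) ⟩
    ∑ Cm (λ ρ → ∑Fin (suc q) (λ c → hit (g (c ∷ ρ)) c))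
  ≡⟨ ∑-cong Cm (λ ρ → trans (∑-cong (finSummation (suc q)) (λ c → cong (λ y → hit y c)
       (ignores (c ∷ ρ) (zero ∷ ρ) (agreeOff-head c zero ρ)))) (∑-hit (g (zero ∷ ρ)))) ⟩
    ∑ Cm (λ _ → 1)
  ≡⟨ ∑-1 Cm ⟩
    suc q ^ m
  ∎)
  where
  open ≡-Reasoning
  Cm : Summation (Vector (Fin (suc q)) m)
  Cm = colourings (suc q) m
∑-hit-ignoring (suc q) {suc m} (suc r) g ignores = begin
    suc q * ∑Fin (suc q) (λ c → ∑ Cm (λ ρ → hit (g (c ∷ ρ)) (ρ r)))
  ≡⟨ ∑-* (finSummation (suc q)) (suc q) (λ c → ∑ Cm (λ ρ → hit (g (c ∷ ρ)) (ρ r))) ⟨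
    ∑Fin (suc q) (λ c → suc q * ∑ Cm (λ ρ → hit (g (c ∷ ρ)) (ρ r)))
  ≡⟨ ∑-cong (finSummation (suc q)) (λ c → ∑-hit-ignoring (suc q) r (g ∘ (c ∷_))
       (λ β β' agree → ignores (c ∷ β) (c ∷ β') (agreeOff-tail c agree))) ⟩
    ∑Fin (suc q) (λ _ → suc q ^ m)
  ≡⟨ ∑-const (finSummation (suc q)) (suc q ^ m) ⟩
    suc q ^ m * suc q
  ≡⟨ *-comm (suc q ^ m) (suc q) ⟩
    suc q ^ suc m
  ∎
  where
  open ≡-Reasoning
  Cm : Summation (Vector (Fin (suc q)) m)
  Cm = colourings (suc q) m

1≤∏miss+∑hit : ∀ {q} m (x y : Vector (Fin q) m) →
  1 ≤ ∏ m (λ r → miss (x r) (y r)) + ∑Fin m (λ r → hit (x r) (y r))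
1≤∏miss+∑hit zero    x y = s≤s z≤n
1≤∏miss+∑hit (suc m) x y =
  1≤[1∸h]*m+[h+n] (hit≤1 (x zero) (y zero)) (1≤∏miss+∑hit m (x ∘ suc) (y ∘ suc))

allMiss : ∀ {q} m → (Fin m → Vector (Fin q) m → Fin q) → Vector (Fin q) m → ℕ
allMiss m g β = ∏ m (λ r → miss (g r β) (β r))

-- Union bound: each colouring is all-miss or is guessed by some player (1≤∏miss+∑hit).
clique-bound : ∀ q m (g : Fin m → Vector (Fin q) m → Fin q) → (∀ r → IgnoresOwn r (g r)) →
  q * q ^ m ≤ q * ∑ (colourings q m) (allMiss m g) + m * q ^ m
clique-bound q m g ignores = begin
    q * q ^ m
  ≡⟨ cong (q *_) (∑-1 C) ⟨
    q * ∑ C (λ _ → 1)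
  ≤⟨ *-monoʳ-≤ q (∑-mono C (λ β → 1≤∏miss+∑hit m (λ r → g r β) β)) ⟩
    q * ∑ C (λ β → allMiss m g β + ∑Fin m (hitAt β))
  ≡⟨ cong (q *_) (∑-+ C (allMiss m g) (λ β → ∑Fin m (hitAt β))) ⟩
    q * (∑ C (allMiss m g) + ∑ C (λ β → ∑Fin m (hitAt β)))
  ≡⟨ *-distribˡ-+ q _ _ ⟩
    q * ∑ C (allMiss m g) + q * ∑ C (λ β → ∑Fin m (hitAt β))
  ≡⟨ cong (λ k → q * ∑ C (allMiss m g) + q * k) (∑-swap C m (λ r β → hitAt β r)) ⟨
    q * ∑ C (allMiss m g) + q * ∑Fin m (λ r → ∑ C (λ β → hitAt β r))
  ≡⟨ cong (q * ∑ C (allMiss m g) +_) (∑-* (finSummation m) q _) ⟨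
    q * ∑ C (allMiss m g) + ∑Fin m (λ r → q * ∑ C (λ β → hitAt β r))
  ≡⟨ cong (q * ∑ C (allMiss m g) +_) (∑-cong (finSummation m)
       (λ r → ∑-hit-ignoring q r (g r) (ignores r))) ⟩
    q * ∑ C (allMiss m g) + ∑Fin m (λ _ → q ^ m)
  ≡⟨ cong (q * ∑ C (allMiss m g) +_) (trans (∑-const (finSummation m) (q ^ m)) (*-comm (q ^ m) m)) ⟩
    q * ∑ C (allMiss m g) + m * q ^ m
  ∎
  where
  open ≤-Reasoning
  C : Summation (Vector (Fin q) m)
  C = colourings q m
  hitAt : Vector (Fin q) m → Fin m → ℕ
  hitAt β r = hit (g r β) (β r)

clique-bound∸ : ∀ q m (g : Fin m → Vector (Fin q) m → Fin q) → (∀ r → IgnoresOwn r (g r)) →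
  (q ∸ m) * q ^ m ≤ q * ∑ (colourings q m) (allMiss m g)
clique-bound∸ q m g ignores = begin
  (q ∸ m) * q ^ m         ≡⟨ *-distribʳ-∸ (q ^ m) q m ⟩
  q * q ^ m ∸ m * q ^ m   ≤⟨ m≤n+o⇒m∸n≤o (q * q ^ m) (m * q ^ m)
                               (subst (q * q ^ m ≤_) (+-comm _ (m * q ^ m)) (clique-bound q m g ignores)) ⟩
  q * ∑ (colourings q m) (allMiss m g) ∎
  where open ≤-Reasoning

-- The centre's guess H is right on exactly card S ^ n of the pairs (x , b).
centre-count : ∀ {A : Set} (S : Summation A) {q n} (ℓ : Fin q → Fin n → A → ℕ) →
  (∀ x p a → ℓ x p a ≤ 1) → (H : Vector A n → Fin q) →
  card S ^ n < ∑Fin q (λ x → ∏ n (λ p → ∑ S (ℓ x p))) →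
  ∃₂ λ x b → H b ≢ x × (∀ p → 0 < ℓ x p (b p))
centre-count {A} S {q} {n} ℓ ℓ≤1 H bound =
  witness (∑-pos Cs _ (+-cancelʳ-< (card S ^ n) 0 _ (<-≤-trans bound bound≤)))
  where
  Cs : Summation (Fin q)
  Cs = finSummation q
  Bs : Summation (Vector A n)
  Bs = vectorSummation S n
  allLose : Fin q → Vector A n → ℕ
  allLose x b = ∏ n (λ p → ℓ x p (b p))
  lose : Fin q → Vector A n → ℕ
  lose x b = miss (H b) x * allLose x b
  bound≤ : ∑ Cs (λ x → ∏ n (λ p → ∑ S (ℓ x p))) ≤ ∑ Cs (λ x → ∑ Bs (lose x)) + card S ^ n
  bound≤ = begin
      ∑ Cs (λ x → ∏ n (λ p → ∑ S (ℓ x p)))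
    ≡⟨ ∑-cong Cs (λ x → ∑⃗-∏ S n (ℓ x)) ⟨
      ∑ Cs (λ x → ∑ Bs (allLose x))
    ≤⟨ ∑-mono Cs (λ x → ∑-mono Bs (λ b →
         L≤[1∸h]*L+h (hit≤1 (H b) x) (∏≤1 n (λ p → ℓ≤1 x p (b p))))) ⟩
      ∑ Cs (λ x → ∑ Bs (λ b → lose x b + hit (H b) x))
    ≡⟨ ∑-cong Cs (λ x → ∑-+ Bs (lose x) (λ b → hit (H b) x)) ⟩
      ∑ Cs (λ x → ∑ Bs (lose x) + ∑ Bs (λ b → hit (H b) x))
    ≡⟨ ∑-+ Cs (λ x → ∑ Bs (lose x)) (λ x → ∑ Bs (λ b → hit (H b) x)) ⟩
      ∑ Cs (λ x → ∑ Bs (lose x)) + ∑ Cs (λ x → ∑ Bs (λ b → hit (H b) x))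
    ≡⟨ cong (∑ Cs (λ x → ∑ Bs (lose x)) +_) (begin-equality
         ∑ Cs (λ x → ∑ Bs (λ b → hit (H b) x))   ≡⟨ ∑-swap Bs q (λ x b → hit (H b) x) ⟩
         ∑ Bs (λ b → ∑ Cs (hit (H b)))          ≡⟨ ∑-cong Bs (λ b → ∑-hit (H b)) ⟩
         ∑ Bs (λ _ → 1)                         ≡⟨ ∑-1 Bs ⟩
         card S ^ n                            ∎) ⟩
      ∑ Cs (λ x → ∑ Bs (lose x)) + card S ^ n
    ∎
    where open ≤-Reasoning
  witness : (∃ λ x → 0 < ∑ Bs (lose x)) → ∃₂ λ x b → H b ≢ x × (∀ p → 0 < ℓ x p (b p))
  witness (x , ∑lose>0) with ∑-pos Bs (lose x) ∑lose>0
  ... | b , lose>0 =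
    x , b , miss>0⇒≢ (H b) x (m*n>0⇒m>0 (miss (H b) x) lose>0)
          , ∏>0⇒>0 n (m*n>0⇒n>0 (miss (H b) x) lose>0)

module Blades (k n : ℕ) where

  M : ℕ
  M = k ∸ 1

  centre : Fin (V (Windmill k n))
  centre = zero

  blade : Fin n → Fin M → Fin (V (Windmill k n))
  blade p r = suc (combine p r)

  vertex-view : ∀ v → v ≡ centre ⊎ ∃₂ λ p r → v ≡ blade p r
  vertex-view zero    = inj₁ refl
  vertex-view (suc i) =
    inj₂ (proj₁ (remQuot {n} M i) , proj₂ (remQuot {n} M i) , cong suc (sym (combine-remQuot {n} M i)))

  blade-adjacent : ∀ p {r r'} → r' ≢ r → Adj (Windmill k n) (blade p r) (blade p r')
  blade-adjacent p {r} {r'} r'≢r =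
      trans (cong proj₁ (remQuot-combine {n} {M} p r)) (sym (cong proj₁ (remQuot-combine {n} {M} p r')))
    , λ eq → r'≢r (sym (combine-injectiveʳ p r p r' eq))

  blade-neighbour : ∀ {p r j} → Adj (Windmill k n) (blade p r) (suc j) →
    ∃ λ r' → j ≡ combine p r' × r' ≢ r
  blade-neighbour {p} {r} {j} (same-blade , r≢j) =
    r' , j≡ , λ r'≡r → r≢j (sym (trans j≡ (cong (combine p) r'≡r)))
    where
    r' : Fin M
    r' = proj₂ (remQuot {n} M j)
    j≡ : j ≡ combine p r'
    j≡ = trans (sym (combine-remQuot {n} M j))
      (cong (λ p' → combine p' r') (trans (sym same-blade) (cong proj₁ (remQuot-combine {n} {M} p r))))

  colouring : ∀ {q} → Fin q → (Fin n → Vector (Fin q) M) → Fin (V (Windmill k n)) → Fin q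
  colouring x b zero    = x
  colouring x b (suc i) = uncurry b (remQuot {n} M i)

  colouring-blade : ∀ {q} (x : Fin q) b p r → colouring x b (blade p r) ≡ b p r
  colouring-blade x b p r = cong (uncurry b) (remQuot-combine {n} {M} p r)

  module _ {q} {s : Strategy (Windmill k n) q} (local : NeighbourLocal (Windmill k n) q s) where

    centre-local : ∀ x x' b → s centre (colouring x b) ≡ s centre (colouring x' b)
    centre-local x x' b = local centre _ _ λ { zero () ; (suc j) _ → refl }

    blade-local : ∀ p r x {b b'} → AgreeOff r (b p) (b' p) →
      s (blade p r) (colouring x b) ≡ s (blade p r) (colouring x b')
    blade-local p r x {b} {b'} agree = local (blade p r) _ _ agrees
      where
      agrees : ∀ u → Adj (Windmill k n) (blade p r) u → colouring x b u ≡ colouring x b' u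
      agrees zero    _   = refl
      agrees (suc j) adj with blade-neighbour adj
      ... | r' , refl , r'≢r = begin
        colouring x b (blade p r')  ≡⟨ colouring-blade x b p r' ⟩
        b p r'                      ≡⟨ agree r' r'≢r ⟩
        b' p r'                     ≡⟨ colouring-blade x b' p r' ⟨
        colouring x b' (blade p r') ∎
        where open ≡-Reasoning

module _ {k n q} (s : Strategy (Windmill k n) q) (local : NeighbourLocal (Windmill k n) q s) where
  open Blades k n

  bladeGuess : Fin n → Fin q → Fin M → Vector (Fin q) M → Fin q
  bladeGuess p x r β = s (blade p r) (colouring x (λ _ → β))

  bladeGuess-ignoresOwn : ∀ p x r → IgnoresOwn r (bladeGuess p x r)
  bladeGuess-ignoresOwn p x r β β' = blade-local local p r x

  bladeMiss : Fin q → Fin n → Vector (Fin q) M → ℕ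
  bladeMiss x p = allMiss M (bladeGuess p x)

  bladeMiss≤1 : ∀ x p β → bladeMiss x p β ≤ 1
  bladeMiss≤1 x p β = ∏≤1 M (λ r → miss≤1 (bladeGuess p x r β) (β r))

  centreGuess : Fin q → (Fin n → Vector (Fin q) M) → Fin q
  centreGuess x b = s centre (colouring x b)

  q>0 : ∀ {a} → q ^ n < q * a → 0 < q
  q>0 q^n<q*a = m*n>0⇒m>0 q (≤-<-trans z≤n q^n<q*a)

  bladeMiss-mass : q ^ n < q * (q ∸ M) ^ n →
    (q ^ M) ^ n < ∑Fin q (λ x → ∏ n (λ p → ∑ (colourings q M) (bladeMiss x p)))
  bladeMiss-mass hyp = *-cancelˡ-< (q ^ n) _ _ (begin-strict
      q ^ n * (q ^ M) ^ n
    <⟨ *-monoˡ-< ((q ^ M) ^ n) {{m^n≢0 (q ^ M) n {{m^n≢0 q M {{>-nonZero (q>0 hyp)}}}}}} hyp ⟩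
      q * (q ∸ M) ^ n * (q ^ M) ^ n
    ≡⟨ trans (*-assoc q _ _) (cong (q *_) (sym (^-distribʳ-* (q ∸ M) (q ^ M) n))) ⟩
      q * ((q ∸ M) * q ^ M) ^ n
    ≡⟨ trans (∑-const (finSummation q) _) (*-comm _ q) ⟨
      ∑Fin q (λ _ → ((q ∸ M) * q ^ M) ^ n)
    ≤⟨ ∑-mono (finSummation q) (λ x → ^≤^*∏ n (λ p →
         clique-bound∸ q M (bladeGuess p x) (bladeGuess-ignoresOwn p x))) ⟩
      ∑Fin q (λ x → q ^ n * ∏ n (λ p → ∑ (colourings q M) (bladeMiss x p)))
    ≡⟨ ∑-* (finSummation q) (q ^ n) _ ⟩
      q ^ n * ∑Fin q (λ x → ∏ n (λ p → ∑ (colourings q M) (bladeMiss x p)))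
    ∎)
    where open ≤-Reasoning

  losing-colouring : q ^ n < q * (q ∸ M) ^ n → ∃ λ c → ∀ v → s v c ≢ c v
  losing-colouring hyp
    with centre-count (colourings q M) bladeMiss bladeMiss≤1
           (centreGuess (fromℕ< (q>0 hyp))) (bladeMiss-mass hyp)
  ... | x , b , guess≢x , bladesMiss = colouring x b , misses
    where
    misses : ∀ v → s v (colouring x b) ≢ colouring x b v
    misses v with vertex-view v
    ... | inj₁ refl = λ correct → guess≢x (trans (centre-local local _ x b) correct)
    ... | inj₂ (p , r , refl) = λ correct → miss>0⇒≢ _ _ (∏>0⇒>0 M (bladesMiss p) r)
          (trans (sym (blade-local local p r x (λ _ _ → refl))) (trans correct (colouring-blade x b p r)))

windmill-no-strategy : ∀ k n q → q ^ n < q * (q ∸ (k ∸ 1)) ^ n → ¬ HasWinningStrategy (Windmill k n) q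
windmill-no-strategy k n q hyp (s , local , wins) with losing-colouring s local hyp
... | c , misses = misses (proj₁ (wins c)) (proj₂ (wins c))

q^n<q*[q∸M]^n : ∀ d' n' {q} → suc d' ^ suc n' < q → q ^ suc n' < q * (q ∸ d' * suc d' ^ n') ^ suc n'
q^n<q*[q∸M]^n d' n' {q} d^n<q = begin-strict
  q ^ n                 ≤⟨ ^-monoˡ-≤ n q≤d*[q∸M] ⟩
  (d * (q ∸ M)) ^ n     ≡⟨ ^-distribʳ-* d (q ∸ M) n ⟩
  d ^ n * (q ∸ M) ^ n   <⟨ *-monoˡ-< ((q ∸ M) ^ n) {{m^n≢0 (q ∸ M) n {{q∸M≢0}}}} d^n<q ⟩
  q * (q ∸ M) ^ n       ∎
  where
  open ≤-Reasoning
  d n A M : ℕ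
  d = suc d'
  n = suc n'
  A = d ^ n'
  M = d' * A
  A≤q∸M : A ≤ q ∸ M
  A≤q∸M = subst (_≤ q ∸ M) (m+n∸n≡m A M) (∸-monoˡ-≤ M (<⇒≤ d^n<q))
  q≤d*[q∸M] : q ≤ d * (q ∸ M)
  q≤d*[q∸M] = begin
    q                      ≡⟨ m∸n+n≡m (≤-trans (m≤n+m M A) (<⇒≤ d^n<q)) ⟨
    (q ∸ M) + M            ≤⟨ +-monoʳ-≤ (q ∸ M) (*-monoʳ-≤ d' A≤q∸M) ⟩
    (q ∸ M) + d' * (q ∸ M) ∎
  q∸M≢0 : NonZero (q ∸ M)
  q∸M≢0 = m*n≢0⇒n≢0 d {{>-nonZero (<-≤-trans (≤-<-trans z≤n d^n<q) q≤d*[q∸M])}}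

[[m+n]%d+[d∸n%d]]%d≡m : ∀ d .{{_ : NonZero d}} m n → m < d → ((m + n) % d + (d ∸ n % d)) % d ≡ m
[[m+n]%d+[d∸n%d]]%d≡m d m n m<d = begin
    ((m + n) % d + (d ∸ n % d)) % d
  ≡⟨ cong (λ k → (k + (d ∸ n % d)) % d) [m+n]%d≡[m+n%d]%d ⟩
    ((m + n % d) % d + (d ∸ n % d)) % d
  ≡⟨ %-distribˡ-+ ((m + n % d) % d) (d ∸ n % d) d ⟩
    ((m + n % d) % d % d + (d ∸ n % d) % d) % d
  ≡⟨ cong (λ k → (k + (d ∸ n % d) % d) % d) (m%n%n≡m%n (m + n % d) d) ⟩
    ((m + n % d) % d + (d ∸ n % d) % d) % d
  ≡⟨ %-distribˡ-+ (m + n % d) (d ∸ n % d) d ⟨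
    (m + n % d + (d ∸ n % d)) % d
  ≡⟨ cong (_% d) (trans (+-assoc m (n % d) _) (cong (m +_) (m+[n∸m]≡n (<⇒≤ (m%n<n n d))))) ⟩
    (m + d) % d
  ≡⟨ [m+n]%n≡m%n m d ⟩
    m % d
  ≡⟨ m<n⇒m%n≡m m<d ⟩
    m
  ∎
  where
  open ≡-Reasoning
  [m+n]%d≡[m+n%d]%d : (m + n) % d ≡ (m + n % d) % d
  [m+n]%d≡[m+n%d]%d = trans (%-distribˡ-+ m n d)
    (trans (cong (λ k → (m % d + k) % d) (sym (m%n%n≡m%n n d))) (sym (%-distribˡ-+ m (n % d) d)))

module SumGuess (q : ℕ) .{{_ : NonZero q}} {m : ℕ} where

  total : Vector (Fin q) m → Fin q
  total β = ∑Fin m (toℕ ∘ β) mod q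

  othersTotal : Fin m → Vector (Fin q) m → ℕ
  othersTotal r β = ∑Fin m (λ r' → miss r r' * toℕ (β r'))

  sumGuess : Fin m → Vector (Fin q) m → Fin q → Fin q
  sumGuess r β t = (toℕ t + (q ∸ othersTotal r β % q)) mod q

  total-cong : ∀ {β β'} → (∀ r → β r ≡ β' r) → total β ≡ total β'
  total-cong β≗β' = cong (_mod q) (∑-cong (finSummation m) (cong toℕ ∘ β≗β'))

  sumGuess-ignoresOwn : ∀ r t → IgnoresOwn r (λ β → sumGuess r β t)
  sumGuess-ignoresOwn r t β β' agree =
    cong (λ R → (toℕ t + (q ∸ R % q)) mod q) (∑-cong (finSummation m) others)
    where
    others : ∀ r' → miss r r' * toℕ (β r') ≡ miss r r' * toℕ (β' r')
    others r' with r' ≟ r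
    ... | yes refl = trans (cong (_* toℕ (β r)) (miss-refl r)) (sym (cong (_* toℕ (β' r)) (miss-refl r)))
    ... | no r'≢r  = cong (λ c → miss r r' * toℕ c) (agree r' r'≢r)

  sumGuess-total : ∀ r β → sumGuess r β (total β) ≡ β r
  sumGuess-total r β = toℕ-injective (begin
      toℕ (sumGuess r β (total β))
    ≡⟨ toℕ-fromℕ< _ ⟩
      (toℕ (total β) + (q ∸ othersTotal r β % q)) % q
    ≡⟨ cong (λ t → (t + (q ∸ othersTotal r β % q)) % q)
         (trans (toℕ-fromℕ< _) (cong (_% q) (∑-split-at r (toℕ ∘ β)))) ⟩
      ((toℕ (β r) + othersTotal r β) % q + (q ∸ othersTotal r β % q)) % q
    ≡⟨ [[m+n]%d+[d∸n%d]]%d≡m q (toℕ (β r)) (othersTotal r β) (toℕ<n (β r)) ⟩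
      toℕ (β r)
    ∎)
    where open ≡-Reasoning

funToFin-cong : ∀ {m n} {f g : Vector (Fin n) m} → (∀ i → f i ≡ g i) → funToFin f ≡ funToFin g
funToFin-cong {zero}  f≗g = refl
funToFin-cong {suc m} f≗g = cong₂ combine (f≗g zero) (funToFin-cong (f≗g ∘ suc))

insertAt-cong : ∀ {A : Set} {n} {xs ys : Vector A n} → (∀ i → xs i ≡ ys i) →
  ∀ i v j → insertAt xs i v j ≡ insertAt ys i v j
insertAt-cong             xs≗ys zero    v zero    = refl
insertAt-cong             xs≗ys zero    v (suc j) = xs≗ys j
insertAt-cong {n = suc n} xs≗ys (suc i) v zero    = xs≗ys zero
insertAt-cong {n = suc n} xs≗ys (suc i) v (suc j) = insertAt-cong (xs≗ys ∘ suc) i v j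

digits : ∀ d n → Fin (d ^ n) → Vector (Fin d) n
digits d n = finToFun

module _ (d' n' : ℕ) where

  otherDigitColour : Fin (suc n') → Fin (suc d' ^ suc n') → Fin (d' * suc d' ^ n') → Fin (suc d' ^ suc n')
  otherDigitColour p x r =
    funToFin (insertAt (digits (suc d') n' rest) p (punchIn (digits (suc d') (suc n') x p) digit))
    where
    digit : Fin d'
    digit = proj₁ (remQuot {d'} (suc d' ^ n') r)
    rest : Fin (suc d' ^ n')
    rest = proj₂ (remQuot {d'} (suc d' ^ n') r)

  otherDigitColour-onto : ∀ p x y → digits (suc d') (suc n') y p ≢ digits (suc d') (suc n') x p →
    ∃ λ r → otherDigitColour p x r ≡ y
  otherDigitColour-onto p x y yₚ≢xₚ = combine digit rest , (begin
      otherDigitColour p x (combine digit rest)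
    ≡⟨ cong (λ (a , w) → funToFin (insertAt (ds n' w) p (punchIn (ds (suc n') x p) a)))
         (remQuot-combine {d'} digit rest) ⟩
      funToFin (insertAt (ds n' rest) p (punchIn (ds (suc n') x p) digit))
    ≡⟨ funToFin-cong (λ j → trans (insertAt-cong (finToFun-funToFin (removeAt (ds (suc n') y) p)) p _ j)
         (cong (λ v → insertAt (removeAt (ds (suc n') y) p) p v j) (punchIn-punchOut xₚ≢yₚ))) ⟩
      funToFin (insertAt (removeAt (ds (suc n') y) p) p (ds (suc n') y p))
    ≡⟨ funToFin-cong (insertAt-removeAt (ds (suc n') y) p) ⟩
      funToFin (ds (suc n') y)
    ≡⟨ funToFin-finToFin {suc n'} {suc d'} y ⟩
      y
    ∎)
    where
    open ≡-Reasoning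
    ds : ∀ m → Fin (suc d' ^ m) → Vector (Fin (suc d')) m
    ds = digits (suc d')
    xₚ≢yₚ : ds (suc n') x p ≢ ds (suc n') y p
    xₚ≢yₚ = yₚ≢xₚ ∘ sym
    digit : Fin d'
    digit = punchOut xₚ≢yₚ
    rest : Fin (suc d' ^ n')
    rest = funToFin (removeAt (ds (suc n') y) p)

module DigitStrategy (k d' n : ℕ) where
  open Blades k n

  q : ℕ
  q = suc d' ^ n

  instance
    q≢0 : NonZero q
    q≢0 = m^n≢0 (suc d') n

  open SumGuess q

  OntoOtherDigits : (Fin n → Fin q → Fin M → Fin q) → Set
  OntoOtherDigits τ =
    ∀ p x y → digits (suc d') n y p ≢ digits (suc d') n x p → ∃ λ r → τ p x r ≡ y

  module _ (τ : Fin n → Fin q → Fin M → Fin q) (τ-onto : OntoOtherDigits τ) where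

    bladeColours : (Fin (V (Windmill k n)) → Fin q) → Fin n → Vector (Fin q) M
    bladeColours c p r = c (blade p r)

    bladeStrategy : (Fin (V (Windmill k n)) → Fin q) → Fin n → Fin M → Fin q
    bladeStrategy c p r = sumGuess r (bladeColours c p) (τ p (c centre) r)

    bladeDigit : (Fin (V (Windmill k n)) → Fin q) → Fin n → Fin (suc d')
    bladeDigit c p = digits (suc d') n (total (bladeColours c p)) p

    strategy : Strategy (Windmill k n) q
    strategy zero    c = funToFin (bladeDigit c)
    strategy (suc i) c = uncurry (bladeStrategy c) (remQuot {n} M i)

    strategy-blade : ∀ c p r → strategy (blade p r) c ≡ bladeStrategy c p r
    strategy-blade c p r = cong (uncurry (bladeStrategy c)) (remQuot-combine {n} {M} p r)

    strategy-local : NeighbourLocal (Windmill k n) q strategy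
    strategy-local v c c' agree with vertex-view v
    ... | inj₁ refl = funToFin-cong (λ p → cong (λ t → digits (suc d') n t p)
                        (total-cong (λ r → agree (blade p r) tt)))
    ... | inj₂ (p , r , refl) = begin
        strategy (blade p r) c
      ≡⟨ strategy-blade c p r ⟩
        sumGuess r (bladeColours c p) (τ p (c centre) r)
      ≡⟨ cong (λ x → sumGuess r (bladeColours c p) (τ p x r)) (agree centre tt) ⟩
        sumGuess r (bladeColours c p) (τ p (c' centre) r)
      ≡⟨ sumGuess-ignoresOwn r _ _ _ (λ r' r'≢r → agree (blade p r') (blade-adjacent p r'≢r)) ⟩
        sumGuess r (bladeColours c' p) (τ p (c' centre) r)
      ≡⟨ strategy-blade c' p r ⟨
        strategy (blade p r) c'
      ∎
      where open ≡-Reasoning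

    strategy-wins : Wins (Windmill k n) q strategy
    strategy-wins c with all? (λ p → bladeDigit c p ≟ digits (suc d') n (c centre) p)
    ... | yes centre-digits = centre ,
      trans (funToFin-cong centre-digits) (funToFin-finToFin {n} {suc d'} (c centre))
    ... | no ¬centre-digits
      with ¬∀⟶∃¬ n _ (λ p → bladeDigit c p ≟ digits (suc d') n (c centre) p) ¬centre-digits
    ...   | p , wrong-digit with τ-onto p (c centre) (total (bladeColours c p)) wrong-digit
    ...     | r , τₚᵣ≡total = blade p r , (begin
        strategy (blade p r) c
      ≡⟨ strategy-blade c p r ⟩
        sumGuess r (bladeColours c p) (τ p (c centre) r)
      ≡⟨ cong (sumGuess r (bladeColours c p)) τₚᵣ≡total ⟩
        sumGuess r (bladeColours c p) (total (bladeColours c p))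
      ≡⟨ sumGuess-total r (bladeColours c p) ⟩
        c (blade p r)
      ∎)
      where open ≡-Reasoning

windmill-wins : ∀ k d' n' → k ∸ 1 ≡ d' * suc d' ^ n' →
  HasWinningStrategy (Windmill k (suc n')) (suc d' ^ suc n')
windmill-wins k d' n' blade-size = strategy τ τ-onto , strategy-local τ τ-onto , strategy-wins τ τ-onto
  where
  open DigitStrategy k d' (suc n')
  τ : Fin (suc n') → Fin q → Fin (k ∸ 1) → Fin q
  τ p x r = otherDigitColour d' n' p x (cast blade-size r)
  τ-onto : OntoOtherDigits τ
  τ-onto p x y yₚ≢xₚ with otherDigitColour-onto d' n' p x y yₚ≢xₚ
  ... | r , hits-y = cast (sym blade-size) r
    , trans (cong (otherDigitColour d' n' p x) (cast-involutive blade-size (sym blade-size) r)) hits-y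

mainTheorem4 : ∀ (n d : ℕ) → 1 ≤ n → 2 ≤ d →
    IsHatGuessingNumber (Windmill (d ^ n ∸ d ^ (n ∸ 1) + 1) n) (d ^ n)
mainTheorem4 zero     d        ()
mainTheorem4 (suc n') zero     _ ()
mainTheorem4 (suc n') (suc d') _ _ =
    windmill-wins k d' n' blade-size
  , λ q d^n<q → windmill-no-strategy k (suc n') q
      (subst (λ M → q ^ suc n' < q * (q ∸ M) ^ suc n') (sym blade-size) (q^n<q*[q∸M]^n d' n' d^n<q))
  where
  k : ℕ
  k = suc d' ^ suc n' ∸ suc d' ^ n' + 1
  blade-size : k ∸ 1 ≡ d' * suc d' ^ n'
  blade-size = trans (m+n∸n≡m _ 1) (m+n∸m≡n (suc d' ^ n') (d' * suc d' ^ n'))
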